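{- Let $n,k,r$ be positive integers with $r\geq 2$ and $n\geq rk$. The circular chromatic number of the $r$-interlacing graph $\mathrm{IG}_{n,k}^{(r)}$ is equal to $n/k$.
   Context: Write $[n]=\{1,\ldots,n\}$ and view its elements as placed in clockwise order on a circle; a $k$-subset of $[n]$ is called a $k$-polygon. A $k$-polygon $P$ is $r$-stable if for every pair of distinct points $a,b\in P$ there are at least $r-1$ elements of $[n]$ between $a$ and $b$ on the circle (in each of the two arcs), i.e. the cyclic distance between any two points of $P$ is at least $r$. Two $k$-polygons $P=\{p_1<\cdots<p_k\}$ and $Q=\{q_1<\cdots<q_k\}$ interlace if either $p_1<q_1<p_2<q_2<\cdots<p_k<q_k$ or $q_1<p_1<q_2<p_2<\cdots<q_k<p_k$. The graph $\mathrm{IG}_{n,k}^{(r)}$ has as vertices the $r$-stable $k$-polygons on $[n]$, two being adjacent iff they interlace. A circular coloring of size $a/b$ of a graph $G=(V,E)$ is a map $\chi:V\to\mathbb{Z}/a\mathbb{Z}$ such that $\chi(v_1)-\chi(v_2)\in\{\overline{b},\overline{b+1},\ldots,\overline{ -b}\}$ whenever $v_1v_2\in E$; the circular chromatic number $\chi_c(G)$ is the minimum rational $a/b$ for which such a coloring exists. -}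

module Defs where

open import Data.Nat using (ℕ; zero; suc; _+_; _*_; _∸_; _≤_; _<_; _⊓_; ∣_-_∣; NonZero)
open import Data.Nat.DivMod using (_%_)
open import Data.Fin using (Fin; toℕ)
import Data.Fin as F
open import Data.Product using (Σ; _×_; _,_)
open import Data.Sum using (_⊎_)
open import Relation.Binary.PropositionalEquality using (_≡_; _≢_)

-- Points of the circle [n] are represented by 0,1,…,n-1 (clockwise).
-- Cyclic distance between two points x,y of the n-cycle.
cycDist : ℕ → ℕ → ℕ → ℕ
cycDist n x y = ∣ x - y ∣ ⊓ (n ∸ ∣ x - y ∣)

-- A k-polygon on [n]: a k-subset of [n], listed in increasing order
-- p 0 < p 1 < … < p (k-1)  (a k-subset corresponds to exactly one such list).
record Polygon (n k : ℕ) : Set where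
  field
    pt      : Fin k → ℕ
    bounded : ∀ i → pt i < n
    incr    : ∀ i j → i F.< j → pt i < pt j
open Polygon public

Stable : ∀ {n k} → ℕ → Polygon n k → Set
Stable {n} r P = ∀ i j → i ≢ j → r ≤ cycDist n (pt P i) (pt P j)

InterlaceL : ∀ {n k} → Polygon n k → Polygon n k → Set
InterlaceL {k = k} P Q =
  (∀ (i : Fin k) → pt P i < pt Q i) ×
  (∀ (i j : Fin k) → toℕ j ≡ suc (toℕ i) → pt Q i < pt P j)

Interlace : ∀ {n k} → Polygon n k → Polygon n k → Set
Interlace P Q = InterlaceL P Q ⊎ InterlaceL Q P

IGVertex : ℕ → ℕ → ℕ → Set
IGVertex n k r = Σ (Polygon n k) (Stable r)

IGAdj : ∀ {n k r} → IGVertex n k r → IGVertex n k r → Set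
IGAdj (P , _) (Q , _) = Interlace P Q

-- A circular coloring of size a/b: χ : V → ℤ/aℤ (represented by Fin a) with
-- χ(v₁) - χ(v₂) mod a ∈ {b, b+1, …, a-b} for every edge v₁v₂.
IsCircularColoring : (a b : ℕ) → .{{_ : NonZero a}} → ∀ {n k r} →
                     (IGVertex n k r → Fin a) → Set
IsCircularColoring a b {n} {k} {r} χ =
  ∀ (v w : IGVertex n k r) → IGAdj v w →
    let d = (a + toℕ (χ v) ∸ toℕ (χ w)) % a in
    (b ≤ d) × (d ≤ a ∸ b)

-- χ_c(IG^{(r)}_{n,k}) = p/q  (p,q > 0): the value p/q is attained by some
-- circular coloring, and every circular coloring of size a/b has a/b ≥ p/q.
CircChromaticIs : (n k r p q : ℕ) → Set
CircChromaticIs n k r p q =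
  (Σ (NonZero p) λ nz → Σ (IGVertex n k r → Fin p) λ χ →
       IsCircularColoring p q {{nz}} χ) ×
  (∀ (a b : ℕ) .{{_ : NonZero a}} → 0 < b →
     (χ : IGVertex n k r → Fin a) → IsCircularColoring a b χ →
     p * b ≤ a * q)

-- Upper bound: colour a polygon by the sum of its points modulo n.  If P and
-- Q interlace, p₁ < q₁ < p₂ < … < q_k < p₁ + n, so the two sums differ by at
-- least k and, going round the other way, by at most n − k.
--
-- Lower bound: the polygons {⌊(x + jn)/k⌋ : j < k}, x ∈ ℤ/n, are r-stable
-- when rk ≤ n, and those for x and x + m interlace whenever k ≤ m ≤ n − k;
-- so they form a copy of the circular clique K_{n/k}.  For an (a, b)-colouring
-- and a colour t, the clique vertices whose colour lies in the window
-- [t, t + b) form an independent set, hence at most k of them; every vertex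
-- lies in exactly b windows, and double counting gives n b ≤ a k.
module Submission where

open import Defs
open import Data.Nat
  using (ℕ; _*_; _≤_; _<_; zero; suc; _+_; _∸_; _⊓_; z≤n; s≤s; _<?_)
open import Data.Nat using (NonZero; >-nonZero; +-0-rawMonoid)
open import Data.Nat.Properties
open import Data.Nat.DivMod
open import Data.Nat.Divisibility using (n∣m*n)
open import Data.Nat.Tactic.RingSolver using (solve-∀)
open import Algebra.Properties.CommutativeSemigroup +-commutativeSemigroup
  using (interchange; xy∙z≈xz∙y; x∙yz≈y∙xz; x∙yz≈xz∙y)
open import Algebra.Definitions.RawMonoid +-0-rawMonoid using (sum)
open import Data.Fin using (Fin; toℕ; fromℕ<; inject₁; fromℕ)
import Data.Fin as Fin
open import Data.Fin.Properties using (toℕ<n; toℕ-injective; toℕ-fromℕ<; toℕ-inject₁)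
open import Data.Product using (∃; _×_; _,_; proj₁)
open import Data.Sum using (_⊎_; inj₁; inj₂)
import Data.Sum as Sum
open import Data.Empty using (⊥-elim)
open import Function using (_∘_)
open import Relation.Nullary using (Dec; yes; no; ¬_; recompute)
open import Relation.Binary.PropositionalEquality
open import Relation.Binary.Definitions using (tri<; tri≈; tri>)

∑ : ℕ → (ℕ → ℕ) → ℕ
∑ zero    f = 0
∑ (suc m) f = f 0 + ∑ m (f ∘ suc)

∑-cong : ∀ m {f g : ℕ → ℕ} → (∀ t → t < m → f t ≡ g t) → ∑ m f ≡ ∑ m g
∑-cong zero    eq = refl
∑-cong (suc m) eq = cong₂ _+_ (eq 0 (s≤s z≤n)) (∑-cong m (λ t → eq (suc t) ∘ s≤s))

∑-mono-≤ : ∀ m {f g : ℕ → ℕ} → (∀ t → t < m → f t ≤ g t) → ∑ m f ≤ ∑ m g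
∑-mono-≤ zero    le = z≤n
∑-mono-≤ (suc m) le = +-mono-≤ (le 0 (s≤s z≤n)) (∑-mono-≤ m (λ t → le (suc t) ∘ s≤s))

∑-const : ∀ m c → ∑ m (λ _ → c) ≡ m * c
∑-const zero    c = refl
∑-const (suc m) c = cong (c +_) (∑-const m c)

∑-split : ∀ m m′ f → ∑ (m + m′) f ≡ ∑ m f + ∑ m′ (λ j → f (m + j))
∑-split zero    m′ f = refl
∑-split (suc m) m′ f =
  trans (cong (f 0 +_) (∑-split m m′ (f ∘ suc))) (sym (+-assoc (f 0) _ _))

∑-last : ∀ m f → ∑ (suc m) f ≡ ∑ m f + f m
∑-last zero    f = +-identityʳ (f 0)
∑-last (suc m) f = trans (cong (f 0 +_) (∑-last m (f ∘ suc))) (sym (+-assoc (f 0) _ _))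

∑-distrib-+ : ∀ m f g → ∑ m (λ j → f j + g j) ≡ ∑ m f + ∑ m g
∑-distrib-+ zero    f g = refl
∑-distrib-+ (suc m) f g =
  trans (cong (f 0 + g 0 +_) (∑-distrib-+ m (f ∘ suc) (g ∘ suc))) (interchange (f 0) (g 0) _ _)

∑-comm : ∀ m m′ (f : ℕ → ℕ → ℕ) →
         ∑ m (λ s → ∑ m′ (f s)) ≡ ∑ m′ (λ t → ∑ m (λ s → f s t))
∑-comm zero    m′ f = sym (trans (∑-const m′ 0) (*-zeroʳ m′))
∑-comm (suc m) m′ f = trans (cong (∑ m′ (f 0) +_) (∑-comm m m′ (f ∘ suc)))
                            (sym (∑-distrib-+ m′ (f 0) (λ t → ∑ m (λ s → f (suc s) t))))

Periodic : {A : Set} → ℕ → (ℕ → A) → Set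
Periodic n h = ∀ x → h (x + n) ≡ h x

∑-rotate : ∀ n h → Periodic n h → ∀ c → ∑ n (λ t → h (t + c)) ≡ ∑ n h
∑-rotate n h periodic zero    = ∑-cong n (λ t _ → cong h (+-identityʳ t))
∑-rotate n h periodic (suc c) = trans (+-cancelˡ-≡ (h c) _ _ shift) (∑-rotate n h periodic c)
  where
  open ≡-Reasoning
  shift : h c + ∑ n (λ t → h (t + suc c)) ≡ h c + ∑ n (λ t → h (t + c))
  shift = begin
    h c + ∑ n (λ t → h (t + suc c))   ≡⟨ cong (h c +_) (∑-cong n (λ t _ → cong h (+-suc t c))) ⟩
    ∑ (suc n) (λ t → h (t + c))        ≡⟨ ∑-last n (λ t → h (t + c)) ⟩
    ∑ n (λ t → h (t + c)) + h (n + c)  ≡⟨ cong (∑ n (λ t → h (t + c)) +_)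
                                              (trans (cong h (+-comm n c)) (periodic c)) ⟩
    ∑ n (λ t → h (t + c)) + h c        ≡⟨ +-comm _ (h c) ⟩
    h c + ∑ n (λ t → h (t + c))        ∎

𝟙 : {P : Set} → Dec P → ℕ
𝟙 (yes _) = 1
𝟙 (no _)  = 0

𝟙≤1 : {P : Set} (p? : Dec P) → 𝟙 p? ≤ 1
𝟙≤1 (yes _) = s≤s z≤n
𝟙≤1 (no _)  = z≤n

𝟙-yes : {P : Set} (p? : Dec P) → P → 𝟙 p? ≡ 1
𝟙-yes (yes _) _ = refl
𝟙-yes (no ¬p) p = ⊥-elim (¬p p)

𝟙-no : {P : Set} (p? : Dec P) → ¬ P → 𝟙 p? ≡ 0
𝟙-no (yes p) ¬p = ⊥-elim (¬p p)
𝟙-no (no _)  _  = refl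

𝟙-exclusive : {P Q : Set} (p? : Dec P) (q? : Dec Q) → ¬ (P × Q) → 𝟙 p? + 𝟙 q? ≤ 1
𝟙-exclusive (yes p) (yes q) ¬pq = ⊥-elim (¬pq (p , q))
𝟙-exclusive (yes _) (no _)  _   = s≤s z≤n
𝟙-exclusive (no _)  q?      _   = 𝟙≤1 q?

∑𝟙≡0⊎∃ : ∀ m {S : ℕ → Set} (S? : ∀ x → Dec (S x)) → ∑ m (𝟙 ∘ S?) ≡ 0 ⊎ ∃ S
∑𝟙≡0⊎∃ zero    S? = inj₁ refl
∑𝟙≡0⊎∃ (suc m) S? with S? 0 | ∑𝟙≡0⊎∃ m (S? ∘ suc)
... | yes s0 | _             = inj₂ (0 , s0)
... | no _   | inj₁ none     = inj₁ none
... | no _   | inj₂ (x , sx) = inj₂ (suc x , sx)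

∑𝟙<-initial : ∀ a b → b ≤ a → ∑ a (λ s → 𝟙 (s <? b)) ≡ b
∑𝟙<-initial a b b≤a = begin
  ∑ a (λ s → 𝟙 (s <? b))
    ≡⟨ cong (λ a′ → ∑ a′ (λ s → 𝟙 (s <? b))) (m+[n∸m]≡n b≤a) ⟨
  ∑ (b + (a ∸ b)) (λ s → 𝟙 (s <? b))
    ≡⟨ ∑-split b (a ∸ b) _ ⟩
  ∑ b (λ s → 𝟙 (s <? b)) + ∑ (a ∸ b) (λ j → 𝟙 (b + j <? b))
    ≡⟨ cong₂ _+_ (∑-cong b (λ s s<b → 𝟙-yes (s <? b) s<b))
                 (∑-cong (a ∸ b) (λ j _ → 𝟙-no (b + j <? b) (≤⇒≯ (m≤m+n b j)))) ⟩
  ∑ b (λ _ → 1) + ∑ (a ∸ b) (λ _ → 0)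
    ≡⟨ cong₂ _+_ (trans (∑-const b 1) (*-identityʳ b))
                 (trans (∑-const (a ∸ b) 0) (*-zeroʳ (a ∸ b))) ⟩
  b + 0
    ≡⟨ +-identityʳ b ⟩
  b ∎
  where open ≡-Reasoning

-- Split the circle as 1 + k + M + k starting at the point 0 of S: the M
-- middle points are too far from 0 to lie in S, and the j-th points of the
-- two outer blocks are n − k − 1 apart, so at most one of them does.
∑-independent∋0≤ : ∀ {n k} {S : ℕ → Set} (S? : ∀ x → Dec (S x)) →
                   suc k + suc k ≤ n → S 0 →
                   (∀ x m → suc k ≤ m → m + suc k ≤ n → S x → ¬ S (x + m)) →
                   ∑ n (𝟙 ∘ S?) ≤ suc k
∑-independent∋0≤ {n} {k} {S} S? 2k≤n S0 independent =
  subst (λ n′ → ∑ n′ (𝟙 ∘ S?) ≤ suc k) n≡ (begin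
    g 0 + ∑ (k + (M + k)) (g ∘ suc)
      ≡⟨ cong (g 0 +_) (∑-split k (M + k) (g ∘ suc)) ⟩
    g 0 + (∑ k (g ∘ suc) + ∑ (M + k) (λ j → g (suc (k + j))))
      ≡⟨ cong (λ z → g 0 + (∑ k (g ∘ suc) + z)) (∑-split M k (λ j → g (suc (k + j)))) ⟩
    g 0 + (∑ k (g ∘ suc) + (∑ M (λ j → g (suc (k + j))) + ∑ k far))
      ≡⟨ cong (λ z → g 0 + (∑ k (g ∘ suc) + (z + ∑ k far)))
              (trans (∑-cong M middle) (trans (∑-const M 0) (*-zeroʳ M))) ⟩
    g 0 + (∑ k (g ∘ suc) + ∑ k far)
      ≡⟨ cong (g 0 +_) (∑-distrib-+ k (g ∘ suc) far) ⟨
    g 0 + ∑ k (λ j → g (suc j) + far j)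
      ≤⟨ +-mono-≤ (𝟙≤1 (S? 0)) (∑-mono-≤ k paired) ⟩
    1 + ∑ k (λ _ → 1)
      ≡⟨ cong suc (trans (∑-const k 1) (*-identityʳ k)) ⟩
    suc k ∎)
  where
  open ≤-Reasoning
  M : ℕ
  M = n ∸ suc (k + k)

  1+2k<n : suc (k + k) < n
  1+2k<n = subst (_≤ n) (cong suc (+-suc k k)) 2k≤n

  0<M : 0 < M
  0<M = m+n≤o⇒m≤o∸n 1 1+2k<n

  n≡ : suc (k + (M + k)) ≡ n
  n≡ = trans (layout k M) (m∸n+n≡m (<⇒≤ 1+2k<n))
    where
    layout : ∀ k M → suc (k + (M + k)) ≡ M + suc (k + k)
    layout = solve-∀

  g : ℕ → ℕ
  g = 𝟙 ∘ S?

  far : ℕ → ℕ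
  far j = g (suc (k + (M + j)))

  middle : ∀ j → j < M → g (suc (k + j)) ≡ 0
  middle j j<M = 𝟙-no (S? _) (independent 0 (suc (k + j)) (s≤s (m≤m+n k j)) fits S0)
    where
    shape : ∀ k j → suc (k + j) + suc k ≡ suc (k + (suc j + k))
    shape = solve-∀
    fits : suc (k + j) + suc k ≤ n
    fits = subst₂ _≤_ (sym (shape k j)) n≡ (s≤s (+-monoʳ-≤ k (+-monoˡ-≤ k j<M)))

  paired : ∀ j → j < k → g (suc j) + far j ≤ 1
  paired j _ = 𝟙-exclusive (S? _) (S? _) λ (s , s′) →
    independent (suc j) (k + M) k<k+M fits s (subst S (shape k M j) s′)
    where
    shape : ∀ k M j → suc (k + (M + j)) ≡ suc j + (k + M)
    shape = solve-∀
    shape′ : ∀ k M → suc (k + (M + k)) ≡ k + M + suc k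
    shape′ = solve-∀
    k<k+M : suc k ≤ k + M
    k<k+M = subst (_≤ k + M) (+-comm k 1) (+-monoʳ-≤ k 0<M)
    fits : k + M + suc k ≤ n
    fits = subst (_≤ n) (shape′ k M) (≤-reflexive n≡)

∑-independent≤ : ∀ {n k} {S : ℕ → Set} (S? : ∀ x → Dec (S x)) → 0 < k → k + k ≤ n →
                 Periodic n (𝟙 ∘ S?) →
                 (∀ x m → k ≤ m → m + k ≤ n → S x → ¬ S (x + m)) →
                 ∑ n (𝟙 ∘ S?) ≤ k
∑-independent≤ {n} {suc k} {S} S? _ 2k≤n periodic independent with ∑𝟙≡0⊎∃ n S?
... | inj₁ empty    = subst (_≤ suc k) (sym empty) z≤n
... | inj₂ (x , Sx) = subst (_≤ suc k) (∑-rotate n (𝟙 ∘ S?) periodic x)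
  (∑-independent∋0≤ (λ t → S? (t + x)) 2k≤n Sx λ t m k<m fits s s′ →
     independent (t + x) m k<m fits s (subst S (xy∙z≈xz∙y t m x) s′))

[m%d+n]%d≡[m+n]%d : ∀ m n d .{{_ : NonZero d}} → (m % d + n) % d ≡ (m + n) % d
[m%d+n]%d≡[m+n]%d m n d = begin
  (m % d + n) % d          ≡⟨ %-distribˡ-+ (m % d) n d ⟩
  (m % d % d + n % d) % d  ≡⟨ cong (λ z → (z + n % d) % d) (m%n%n≡m%n m d) ⟩
  (m % d + n % d) % d      ≡⟨ %-distribˡ-+ m n d ⟨
  (m + n) % d              ∎
  where open ≡-Reasoning

[m+n]%d-cases : ∀ m n d .{{_ : NonZero d}} → n < d →
                (m + n) % d ≡ m % d + n ⊎ (m + n) % d + d ≡ m % d + n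
[m+n]%d-cases m n d n<d with m % d + n <? d
... | yes s<d = inj₁ (trans (sym ([m%d+n]%d≡[m+n]%d m n d)) (m<n⇒m%n≡m s<d))
... | no s≮d  =
  inj₂ (trans (cong (_+ d) (trans (sym ([m%d+n]%d≡[m+n]%d m n d)) wrap)) (m∸n+n≡m d≤s))
  where
  d≤s : d ≤ m % d + n
  d≤s = ≮⇒≥ s≮d
  wrap : (m % d + n) % d ≡ m % d + n ∸ d
  wrap = trans (sym (m≤n⇒[n∸m]%m≡n%m d≤s))
               (m<n⇒m%n≡m (m<n+o⇒m∸n<o _ d (+-mono-< (m%n<n m d) n<d)))

%-difference : ∀ {n} .{{_ : NonZero n}} x y e → e < n → x % n ≡ (y + e) % n →
               (n + x % n ∸ y % n) % n ≡ e
%-difference {n} x y e e<n x≡y+e with [m+n]%d-cases y e n e<n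
... | inj₁ stays = begin
  (n + x % n ∸ y % n) % n         ≡⟨ cong (λ z → (n + z ∸ y % n) % n) (trans x≡y+e stays) ⟩
  (n + (y % n + e) ∸ y % n) % n   ≡⟨ cong (λ z → (z ∸ y % n) % n) (x∙yz≈xz∙y n (y % n) e) ⟩
  (n + e + y % n ∸ y % n) % n     ≡⟨ cong (_% n) (m+n∸n≡m (n + e) (y % n)) ⟩
  (n + e) % n                     ≡⟨ cong (_% n) (+-comm n e) ⟩
  (e + n) % n                     ≡⟨ [m+n]%n≡m%n e n ⟩
  e % n                           ≡⟨ m<n⇒m%n≡m e<n ⟩
  e                               ∎
  where open ≡-Reasoning
... | inj₂ wraps = begin
  (n + x % n ∸ y % n) % n  ≡⟨ cong (λ z → (z ∸ y % n) % n) n+x%n≡y%n+e ⟩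
  (y % n + e ∸ y % n) % n  ≡⟨ cong (_% n) (m+n∸m≡n (y % n) e) ⟩
  e % n                    ≡⟨ m<n⇒m%n≡m e<n ⟩
  e                        ∎
  where
  open ≡-Reasoning
  n+x%n≡y%n+e : n + x % n ≡ y % n + e
  n+x%n≡y%n+e = trans (+-comm n (x % n)) (trans (cong (_+ n) x≡y+e) wraps)

Separated : (a b : ℕ) .{{_ : NonZero a}} → Fin a → Fin a → Set
Separated a b u v = let δ = (a + toℕ u ∸ toℕ v) % a in b ≤ δ × δ ≤ a ∸ b

separated⇒¬both-in-window : ∀ {a b} .{{_ : NonZero a}} {u v : Fin a} → Separated a b u v →
                            ∀ t → (t + toℕ u) % a < b → ¬ ((t + toℕ v) % a < b)
separated⇒¬both-in-window {a} {b} {u} {v} (b≤δ , δ≤a∸b) t u∈ v∈ =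
  <⇒≱ u∈ (≤-trans b≤δ (subst (δ ≤_) δ+w≡ (m≤m+n δ w)))
  where
  open ≡-Reasoning
  X = a + toℕ u ∸ toℕ v
  δ = X % a
  w = (t + toℕ v) % a

  δ+w<a : δ + w < a
  δ+w<a = <-≤-trans (+-monoʳ-< δ v∈) (subst (δ + b ≤_) (m∸n+n≡m b≤a) (+-monoˡ-≤ b δ≤a∸b))
    where
    b≤a : b ≤ a
    b≤a = ≤-trans b≤δ (<⇒≤ (m%n<n X a))

  X+t+v≡t+u+a : X + (t + toℕ v) ≡ t + toℕ u + a
  X+t+v≡t+u+a = begin
    X + (t + toℕ v)   ≡⟨ x∙yz≈y∙xz X t (toℕ v) ⟩
    t + (X + toℕ v)   ≡⟨ cong (t +_) (m∸n+n≡m v≤a+u) ⟩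
    t + (a + toℕ u)   ≡⟨ cong (t +_) (+-comm a (toℕ u)) ⟩
    t + (toℕ u + a)   ≡⟨ +-assoc t (toℕ u) a ⟨
    t + toℕ u + a     ∎
    where
    v≤a+u : toℕ v ≤ a + toℕ u
    v≤a+u = ≤-trans (<⇒≤ (toℕ<n v)) (m≤m+n a (toℕ u))

  δ+w≡ : δ + w ≡ (t + toℕ u) % a
  δ+w≡ = begin
    δ + w                  ≡⟨ m<n⇒m%n≡m δ+w<a ⟨
    (δ + w) % a            ≡⟨ %-distribˡ-+ X (t + toℕ v) a ⟨
    (X + (t + toℕ v)) % a  ≡⟨ cong (_% a) X+t+v≡t+u+a ⟩
    (t + toℕ u + a) % a    ≡⟨ [m+n]%n≡m%n (t + toℕ u) a ⟩
    (t + toℕ u) % a        ∎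

∑-window : ∀ a b .{{_ : NonZero a}} → b ≤ a → ∀ u → ∑ a (λ t → 𝟙 ((t + u) % a <? b)) ≡ b
∑-window a b b≤a u = begin
  ∑ a (λ t → 𝟙 ((t + u) % a <? b))  ≡⟨ ∑-rotate a (λ s → 𝟙 (s % a <? b))
                                          (λ s → cong (λ z → 𝟙 (z <? b)) ([m+n]%n≡m%n s a)) u ⟩
  ∑ a (λ s → 𝟙 (s % a <? b))        ≡⟨ ∑-cong a (λ s s<a → cong (λ z → 𝟙 (z <? b))
                                                                (m<n⇒m%n≡m s<a)) ⟩
  ∑ a (λ s → 𝟙 (s <? b))            ≡⟨ ∑𝟙<-initial a b b≤a ⟩
  b                                 ∎
  where open ≡-Reasoning

circularClique-coloring-bound :
  ∀ {n k a b} .{{_ : NonZero a}} → 0 < k → k + k ≤ n →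
  (c : ℕ → Fin a) → Periodic n c →
  (∀ i m → k ≤ m → m + k ≤ n → Separated a b (c i) (c (i + m))) →
  n * b ≤ a * k
circularClique-coloring-bound {n} {k} {a} {b} 0<k 2k≤n c periodic separated = begin
  n * b                                   ≡⟨ ∑-const n b ⟨
  ∑ n (λ _ → b)                            ≡⟨ ∑-cong n (λ i _ → ∑-window a b b≤a (toℕ (c i))) ⟨
  ∑ n (λ i → ∑ a (λ t → 𝟙 (window? t i)))  ≡⟨ ∑-comm a n (λ t → 𝟙 ∘ window? t) ⟨
  ∑ a (λ t → ∑ n (𝟙 ∘ window? t))          ≤⟨ ∑-mono-≤ a (λ t _ → window-small t) ⟩
  ∑ a (λ _ → k)                            ≡⟨ ∑-const a k ⟩
  a * k                                   ∎
  where
  open ≤-Reasoning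
  window? : ∀ t i → Dec ((t + toℕ (c i)) % a < b)
  window? t i = (t + toℕ (c i)) % a <? b

  window-small : ∀ t → ∑ n (𝟙 ∘ window? t) ≤ k
  window-small t = ∑-independent≤ (window? t) 0<k 2k≤n
    (λ i → cong (λ v → 𝟙 ((t + toℕ v) % a <? b)) (periodic i))
    (λ i m k≤m m+k≤n → separated⇒¬both-in-window (separated i m k≤m m+k≤n) t)

  b≤a : b ≤ a
  b≤a = ≤-trans (proj₁ (separated 0 k ≤-refl 2k≤n)) (<⇒≤ (m%n<n _ a))

cycDist-comm : ∀ n p q → cycDist n p q ≡ cycDist n q p
cycDist-comm n p q = cong (λ z → z ⊓ (n ∸ z)) (∣-∣-comm p q)

cycDist-≥ : ∀ {n p q r} → p + r ≤ q → q + r ≤ p + n → r ≤ cycDist n p q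
cycDist-≥ {n} {p} {q} {r} p+r≤q q+r≤p+n =
  subst (λ z → r ≤ z ⊓ (n ∸ z)) (sym (m≤n⇒∣m-n∣≡n∸m p≤q)) (⊓-glb r≤q∸p r≤n∸[q∸p])
  where
  p≤q : p ≤ q
  p≤q = ≤-trans (m≤m+n p r) p+r≤q
  r≤q∸p : r ≤ q ∸ p
  r≤q∸p = m+n≤o⇒m≤o∸n r (subst (_≤ q) (+-comm p r) p+r≤q)
  r≤n∸[q∸p] : r ≤ n ∸ (q ∸ p)
  r≤n∸[q∸p] = m+n≤o⇒m≤o∸n r (subst (_≤ n) (trans (+-∸-comm r p≤q) (+-comm (q ∸ p) r))
                                     (m≤n+o⇒m∸n≤o (q + r) p q+r≤p+n))

module _ (d : ℕ) .{{_ : NonZero d}} where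

  [m+o*d]/d≡m/d+o : ∀ m o → (m + o * d) / d ≡ m / d + o
  [m+o*d]/d≡m/d+o m o = trans (+-distrib-/-∣ʳ m (n∣m*n o)) (cong (m / d +_) (m*n/n≡m o d))

  m+o*d≤p⇒m/d+o≤p/d : ∀ m o p → m + o * d ≤ p → m / d + o ≤ p / d
  m+o*d≤p⇒m/d+o≤p/d m o p le = subst (_≤ p / d) ([m+o*d]/d≡m/d+o m o) (/-monoˡ-≤ d le)

  p≤m+o*d⇒p/d≤m/d+o : ∀ m o p → p ≤ m + o * d → p / d ≤ m / d + o
  p≤m+o*d⇒p/d≤m/d+o m o p le = subst (p / d ≤_) ([m+o*d]/d≡m/d+o m o) (/-monoˡ-≤ d le)

  m+d≤p⇒m/d<p/d : ∀ m p → m + d ≤ p → m / d < p / d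
  m+d≤p⇒m/d<p/d m p le = subst (_≤ p / d) (+-comm (m / d) 1)
    (m+o*d≤p⇒m/d+o≤p/d m 1 p (subst (λ z → m + z ≤ p) (sym (*-identityˡ d)) le))

module RegularPolygon (n k r : ℕ) .{{_ : NonZero n}} .{{_ : NonZero k}}
                      (k≤n : k ≤ n) (rk≤n : r * k ≤ n) where

  regularPt : ℕ → Fin k → ℕ
  regularPt x j = (x + toℕ j * n) / k

  spread : ∀ x (i j : Fin k) → toℕ i < toℕ j → x + toℕ i * n + n ≤ x + toℕ j * n
  spread x i j i<j = subst (_≤ x + toℕ j * n) (sym (+-assoc x _ n))
    (+-monoʳ-≤ x (subst (_≤ toℕ j * n) (+-comm n _) (*-monoˡ-≤ n i<j)))

  regularPt<n : ∀ {x} → x < n → ∀ j → regularPt x j < n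
  regularPt<n {x} x<n j = m<n*o⇒m/o<n (subst (x + toℕ j * n <_) (*-comm k n)
    (<-≤-trans (+-monoˡ-< (toℕ j * n) x<n) (*-monoˡ-≤ n (toℕ<n j))))

  -- The bound x < n is irrelevant, so that regular x depends on x alone
  -- (regularVertex-cong).
  regular : (x : ℕ) → .(x < n) → Polygon n k
  regular x x<n = record
    { pt      = regularPt x
    ; bounded = regularPt<n (recompute (_ <? n) x<n)
    ; incr    = λ i j i<j →
        m+d≤p⇒m/d<p/d k _ _ (≤-trans (+-monoʳ-≤ _ k≤n) (spread x i j i<j))
    }

  regularPt-far : ∀ x (i j : Fin k) → toℕ i < toℕ j → r ≤ cycDist n (regularPt x i) (regularPt x j)
  regularPt-far x i j i<j = cycDist-≥ near around
    where
    near : regularPt x i + r ≤ regularPt x j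
    near = m+o*d≤p⇒m/d+o≤p/d k _ r _
             (≤-trans (+-monoʳ-≤ (x + toℕ i * n) rk≤n) (spread x i j i<j))

    jn≤[n∸r]k : toℕ j * n ≤ (n ∸ r) * k
    jn≤[n∸r]k = begin
      toℕ j * n      ≤⟨ m+n≤o⇒m≤o∸n (toℕ j * n)
                          (subst (_≤ k * n) (+-comm n _) (*-monoˡ-≤ n (toℕ<n j))) ⟩
      k * n ∸ n      ≡⟨ cong (_∸ n) (*-comm k n) ⟩
      n * k ∸ n      ≤⟨ ∸-monoʳ-≤ (n * k) rk≤n ⟩
      n * k ∸ r * k  ≡⟨ *-distribʳ-∸ k n r ⟨
      (n ∸ r) * k    ∎
      where open ≤-Reasoning

    within : regularPt x j ≤ regularPt x i + (n ∸ r)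
    within = p≤m+o*d⇒p/d≤m/d+o k _ (n ∸ r) _ (subst (x + toℕ j * n ≤_) (sym (+-assoc x _ _))
               (+-monoʳ-≤ x (≤-trans jn≤[n∸r]k (m≤n+m _ _))))

    around : regularPt x j + r ≤ regularPt x i + n
    around = subst (regularPt x j + r ≤_)
      (trans (+-assoc (regularPt x i) _ r) (cong (regularPt x i +_) (m∸n+n≡m r≤n)))
      (+-monoˡ-≤ r within)
      where
      r≤n : r ≤ n
      r≤n = ≤-trans (m≤m*n r k) rk≤n

  regular-stable : ∀ x .(x<n : x < n) → Stable r (regular x x<n)
  regular-stable x _ i j i≢j with <-cmp (toℕ i) (toℕ j)
  ... | tri< i<j _ _ = regularPt-far x i j i<j
  ... | tri≈ _ i≡j _ = ⊥-elim (i≢j (toℕ-injective i≡j))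
  ... | tri> _ _ j<i = subst (r ≤_) (cycDist-comm n (regularPt x j) (regularPt x i)) (regularPt-far x j i j<i)

  regular-interlace : ∀ {x y} .(x<n : x < n) .(y<n : y < n) → x + k ≤ y → y + k ≤ x + n →
                      InterlaceL (regular x x<n) (regular y y<n)
  regular-interlace {x} {y} _ _ x+k≤y y+k≤x+n = ahead , behind
    where
    ahead : ∀ j → regularPt x j < regularPt y j
    ahead j = m+d≤p⇒m/d<p/d k _ _
      (subst (_≤ y + toℕ j * n) (xy∙z≈xz∙y x k (toℕ j * n)) (+-monoˡ-≤ (toℕ j * n) x+k≤y))

    behind : ∀ i j → toℕ j ≡ suc (toℕ i) → regularPt y i < regularPt x j
    behind i j j≡1+i = subst (λ z → regularPt y i < (x + z * n) / k) (sym j≡1+i)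
      (m+d≤p⇒m/d<p/d k _ _ (subst₂ _≤_ (xy∙z≈xz∙y y k (toℕ i * n)) (+-assoc x n (toℕ i * n))
                                     (+-monoˡ-≤ (toℕ i * n) y+k≤x+n)))

  regularVertex : (x : ℕ) → .(x < n) → IGVertex n k r
  regularVertex x x<n = regular x x<n , regular-stable x x<n

  regularVertex-cong : ∀ {x y} .{x<n : x < n} .{y<n : y < n} → x ≡ y →
                       regularVertex x x<n ≡ regularVertex y y<n
  regularVertex-cong refl = refl

  cliqueVertex : ℕ → IGVertex n k r
  cliqueVertex i = regularVertex (i % n) (m%n<n i n)

  cliqueVertex-periodic : Periodic n cliqueVertex
  cliqueVertex-periodic i = regularVertex-cong ([m+n]%n≡m%n i n)

  cliqueVertex-adjacent : ∀ {i m} → 0 < k → k ≤ m → m + k ≤ n →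
                          IGAdj (cliqueVertex i) (cliqueVertex (i + m))
  cliqueVertex-adjacent {i} {m} 0<k k≤m m+k≤n =
    Sum.map forward backward ([m+n]%d-cases i m n (<-≤-trans (m<m+n m 0<k) m+k≤n))
    where
    x = i % n
    y = (i + m) % n

    x+k≤x+m : x + k ≤ x + m
    x+k≤x+m = +-monoʳ-≤ x k≤m

    x+m+k≤x+n : x + m + k ≤ x + n
    x+m+k≤x+n = subst (_≤ x + n) (sym (+-assoc x m k)) (+-monoʳ-≤ x m+k≤n)

    forward : y ≡ x + m → InterlaceL (regular x (m%n<n i n)) (regular y (m%n<n (i + m) n))
    forward y≡x+m = regular-interlace (m%n<n i n) (m%n<n (i + m) n)
      (subst (x + k ≤_) (sym y≡x+m) x+k≤x+m)
      (subst (λ z → z + k ≤ x + n) (sym y≡x+m) x+m+k≤x+n)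

    backward : y + n ≡ x + m → InterlaceL (regular y (m%n<n (i + m) n)) (regular x (m%n<n i n))
    backward y+n≡x+m = regular-interlace (m%n<n (i + m) n) (m%n<n i n)
      (+-cancelʳ-≤ n _ _ (subst (_≤ x + n) (sym (trans (xy∙z≈xz∙y y k n) (cong (_+ k) y+n≡x+m)))
                                          x+m+k≤x+n))
      (subst (x + k ≤_) (sym y+n≡x+m) x+k≤x+m)

sum-< : ∀ {m} (f g : Fin m → ℕ) → (∀ j → f j < g j) → sum f + m ≤ sum g
sum-< {zero}  f g f<g = z≤n
sum-< {suc m} f g f<g = subst (_≤ sum g) (shape (f Fin.zero) (sum (f ∘ Fin.suc)) m)
  (+-mono-≤ (f<g Fin.zero) (sum-< (f ∘ Fin.suc) (g ∘ Fin.suc) (f<g ∘ Fin.suc)))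
  where
  shape : ∀ a s m → suc a + (s + m) ≡ a + s + suc m
  shape = solve-∀

sum-<-shifted : ∀ {m} N (f g : Fin (suc m) → ℕ) → (∀ j → f (inject₁ j) < g (Fin.suc j)) →
                f (fromℕ m) < N → sum f + suc m ≤ sum (g ∘ Fin.suc) + N
sum-<-shifted {zero}  N f g _ f<N = subst (_≤ N) (+-comm 1 (f Fin.zero + 0))
  (subst (λ z → suc z ≤ N) (sym (+-identityʳ _)) f<N)
sum-<-shifted {suc m} N f g f<g f<N =
  subst₂ _≤_ (shape (f Fin.zero) (sum (f ∘ Fin.suc)) m)
             (sym (+-assoc (g (Fin.suc Fin.zero)) (sum (g ∘ Fin.suc ∘ Fin.suc)) N))
    (+-mono-≤ (f<g Fin.zero) (sum-<-shifted N (f ∘ Fin.suc) (g ∘ Fin.suc) (f<g ∘ Fin.suc) f<N))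
  where
  shape : ∀ a s m → suc a + (s + suc m) ≡ a + s + suc (suc m)
  shape = solve-∀

weight : ∀ {n k} → Polygon n k → ℕ
weight P = sum (pt P)

weight-interlace : ∀ {n k} {P Q : Polygon n k} → InterlaceL P Q →
                   weight P + k ≤ weight Q × weight Q + k ≤ weight P + n
weight-interlace {k = zero} _ = z≤n , z≤n
weight-interlace {n} {suc k} {P} {Q} (P<Q , Q<next) =
  sum-< (pt P) (pt Q) P<Q ,
  ≤-trans (sum-<-shifted n (pt Q) (pt P)
             (λ j → Q<next (inject₁ j) (Fin.suc j) (cong suc (sym (toℕ-inject₁ j))))
             (bounded Q (fromℕ k)))
          (+-monoˡ-≤ n (m≤n+m _ (pt P Fin.zero)))

module _ (n : ℕ) .{{_ : NonZero n}} where

  residue : ℕ → Fin n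
  residue x = fromℕ< (m%n<n x n)

  residue-separated : ∀ {k x y z} → 0 < k → y + k ≤ z → z + k ≤ y + n → z % n ≡ x % n →
                      Separated n k (residue x) (residue y)
  residue-separated {k} {x} {y} {z} 0<k y+k≤z z+k≤y+n z≡x =
    subst (λ δ → k ≤ δ × δ ≤ n ∸ k) (sym δ≡e) (k≤e , m+n≤o⇒m≤o∸n e e+k≤n)
    where
    e = z ∸ y
    k≤e : k ≤ e
    k≤e = m+n≤o⇒m≤o∸n k (subst (_≤ z) (+-comm y k) y+k≤z)
    y≤z : y ≤ z
    y≤z = ≤-trans (m≤m+n y k) y+k≤z
    e+k≤n : e + k ≤ n
    e+k≤n = subst (_≤ n) (+-∸-comm k y≤z) (m≤n+o⇒m∸n≤o (z + k) y z+k≤y+n)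
    e<n : e < n
    e<n = <-≤-trans (m<m+n e 0<k) e+k≤n
    x≡y+e : x % n ≡ (y + e) % n
    x≡y+e = trans (sym z≡x) (cong (_% n) (sym (m+[n∸m]≡n y≤z)))
    δ≡e : (n + toℕ (residue x) ∸ toℕ (residue y)) % n ≡ e
    δ≡e = trans (cong₂ (λ u v → (n + u ∸ v) % n) (toℕ-fromℕ< (m%n<n x n)) (toℕ-fromℕ< (m%n<n y n)))
                (%-difference x y e e<n x≡y+e)

  residue-isCircularColoring : ∀ {k r} → 0 < k →
                               IsCircularColoring n k {n} {k} {r} (residue ∘ weight ∘ proj₁)
  residue-isCircularColoring {k} 0<k (P , _) (Q , _) (inj₁ P<Q) with weight-interlace {P = P} {Q} P<Q
  ... | P+k≤Q , Q+k≤P+n = residue-separated 0<k Q+k≤P+n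
          (subst (_≤ weight Q + n) (xy∙z≈xz∙y (weight P) k n) (+-monoˡ-≤ n P+k≤Q))
          ([m+n]%n≡m%n (weight P) n)
  residue-isCircularColoring 0<k (P , _) (Q , _) (inj₂ Q<P) with weight-interlace {P = Q} {P} Q<P
  ... | Q+k≤P , P+k≤Q+n = residue-separated 0<k Q+k≤P P+k≤Q+n refl

theorem1 : ∀ (n k r : ℕ) → 0 < n → 0 < k → 2 ≤ r → r * k ≤ n →
    CircChromaticIs n k r n k
theorem1 n k r 0<n 0<k 2≤r rk≤n =
  (nonZero-n , residue n ∘ weight ∘ proj₁ , residue-isCircularColoring n 0<k) ,
  λ a b _ χ coloring →
    circularClique-coloring-bound 0<k 2k≤n (χ ∘ cliqueVertex) (cong χ ∘ cliqueVertex-periodic)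
      (λ i m k≤m m+k≤n → coloring _ _ (cliqueVertex-adjacent 0<k k≤m m+k≤n))
  where
  instance
    nonZero-n : NonZero n
    nonZero-n = >-nonZero 0<n
    nonZero-k : NonZero k
    nonZero-k = >-nonZero 0<k

  2k≤n : k + k ≤ n
  2k≤n = ≤-trans (subst (_≤ r * k) (cong (k +_) (+-identityʳ k)) (*-monoˡ-≤ k 2≤r)) rk≤n

  open RegularPolygon n k r (≤-trans (m≤m+n k k) 2k≤n) rk≤n
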